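{- Let $\varphi$ be a formula, $x,y$ variables and $M$ a structure. If $\langle x,y\rangle\in eq(\varphi)$ then $\|\varphi\|_M\subseteq\mathrm D_{xy}$; and if $\langle x,y\rangle\in coeq(\varphi)$ then $\overline{\|\varphi\|_M}\subseteq\mathrm D_{xy}$.
   Context: Language: finite set $\mathcal R$ of relation symbols with arities $\delta(r)$; finite set $\mathcal X$ of variables. Formulas: $1$; $r(x_1,\ldots,x_n)$; $(x\approx y)$; $\neg\varphi$; $\varphi\wedge\psi$; $\varphi\vee\psi$; $(\exists x)\varphi$. A structure $M$: nonempty finite set $M$ with $r^M\subseteq M^{\delta(r)}$. $\mathcal V=M^{\mathcal X}$, $\overline V=\mathcal V\setminus V$, $\mathrm C_x(V)=\{v:\exists u\in V,\ u(z)=v(z)\ \forall z\neq x\}$, $\mathrm D_{xy}=\{v:v(x)=v(y)\}$. Value: $\|1\|=\mathcal V$, $\|r(x_1,\ldots,x_n)\|=\{v:(v(x_1),\ldots,v(x_n))\in r^M\}$, $\|x\approx y\|=\mathrm D_{xy}$, $\|\neg\varphi\|=\overline{\|\varphi\|}$, $\wedge\mapsto\cap$, $\vee\mapsto\cup$, $\|(\exists x)\varphi\|=\mathrm C_x(\|\varphi\|)$. $\mathrm{Eq}(R)$ is the least equivalence on $\mathcal X$ containing $R$; $\mathrm{id}_{\mathcal X}$ the identity. In the definition below $\varphi\vee\psi$ is treated as $\neg(\neg\varphi\wedge\neg\psi)$. $eq(1)=coeq(1)=\mathrm{id}_{\mathcal X}$; $eq(r(\ldots))=coeq(r(\ldots))=\mathrm{id}_{\mathcal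 X}$; $eq(x_1\approx x_2)=\mathrm{Eq}(\{\langle x_1,x_2\rangle\})$, $coeq(x_1\approx x_2)=\mathrm{id}_{\mathcal X}$; $eq(\neg\varphi)=coeq(\varphi)$, $coeq(\neg\varphi)=eq(\varphi)$; $eq(\varphi\wedge\psi)=\mathrm{Eq}(eq(\varphi)\cup eq(\psi))$, $coeq(\varphi\wedge\psi)=coeq(\varphi)\cap coeq(\psi)$; $eq((\exists x)\varphi)=\mathrm{Eq}(eq(\varphi)\cap(\mathcal X\setminus\{x\})^2)$, $coeq((\exists x)\varphi)=\mathrm{Eq}(coeq(\varphi)\cap(\mathcal X\setminus\{x\})^2)$. -}

module Defs where

open import Data.Nat using (ℕ; suc)
open import Data.Fin using (Fin)
open import Data.Product using (_×_; ∃)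
open import Data.Sum using (_⊎_)
open import Data.Unit using (⊤)
open import Relation.Nullary using (¬_)
open import Relation.Binary.PropositionalEquality using (_≡_)

record Language : Set where
  field
    nR : ℕ
    δ  : Fin nR → ℕ
    nX : ℕ

module _ (L : Language) where
  open Language L

  Var : Set
  Var = Fin nX

  data Formula : Set where
    one  : Formula
    rel  : (r : Fin nR) → (Fin (δ r) → Var) → Formula
    _≈ᶠ_ : Var → Var → Formula
    ¬ᶠ_  : Formula → Formula
    _∧ᶠ_ : Formula → Formula → Formula
    _∨ᶠ_ : Formula → Formula → Formula
    ∃ᶠ   : Var → Formula → Formula

  record Structure : Set₁ where
    field
      m   : ℕ
      rel^ : (r : Fin nR) → (Fin (δ r) → Fin (suc m)) → Set

  BinRel : Set₁
  BinRel = Var → Var → Set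

  data EqCl (R : BinRel) : BinRel where
    base  : ∀ {x y} → R x y → EqCl R x y
    refl  : ∀ {x} → EqCl R x x
    sym   : ∀ {x y} → EqCl R x y → EqCl R y x
    trans : ∀ {x y z} → EqCl R x y → EqCl R y z → EqCl R x z

  idX : BinRel
  idX x y = x ≡ y

  single : Var → Var → BinRel
  single a b x y = (x ≡ a) × (y ≡ b)

  _∪ᴿ_ : BinRel → BinRel → BinRel
  (R ∪ᴿ S) x y = R x y ⊎ S x y

  _∩ᴿ_ : BinRel → BinRel → BinRel
  (R ∩ᴿ S) x y = R x y × S x y

  avoid : Var → BinRel
  avoid v x y = (¬ x ≡ v) × (¬ y ≡ v)

  -- eq and coeq; φ ∨ ψ is treated as ¬(¬φ ∧ ¬ψ), whence
  --   eq(φ∨ψ)   = coeq(¬φ∧¬ψ) = eq φ ∩ eq ψ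
  --   coeq(φ∨ψ) = eq(¬φ∧¬ψ)   = Eq(coeq φ ∪ coeq ψ)
  eq coeq : Formula → BinRel
  eq one = idX
  eq (rel r xs) = idX
  eq (a ≈ᶠ b) = EqCl (single a b)
  eq (¬ᶠ φ) = coeq φ
  eq (φ ∧ᶠ ψ) = EqCl (eq φ ∪ᴿ eq ψ)
  eq (φ ∨ᶠ ψ) = eq φ ∩ᴿ eq ψ
  eq (∃ᶠ v φ) = EqCl (eq φ ∩ᴿ avoid v)
  coeq one = idX
  coeq (rel r xs) = idX
  coeq (a ≈ᶠ b) = idX
  coeq (¬ᶠ φ) = eq φ
  coeq (φ ∧ᶠ ψ) = coeq φ ∩ᴿ coeq ψ
  coeq (φ ∨ᶠ ψ) = EqCl (coeq φ ∪ᴿ coeq ψ)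
  coeq (∃ᶠ v φ) = EqCl (coeq φ ∩ᴿ avoid v)

  module Sem (M : Structure) where
    open Structure M

    Carrier : Set
    Carrier = Fin (suc m)

    Asg : Set
    Asg = Var → Carrier

    Subset : Set₁
    Subset = Asg → Set

    _⊆_ : Subset → Subset → Set
    V ⊆ W = ∀ v → V v → W v

    complement : Subset → Subset
    complement V v = ¬ V v

    C : Var → Subset → Subset
    C x V v = ∃ λ u → V u × (∀ z → ¬ z ≡ x → u z ≡ v z)

    D : Var → Var → Subset
    D x y v = v x ≡ v y

    ⟦_⟧ : Formula → Subset
    ⟦ one ⟧ v = ⊤
    ⟦ rel r xs ⟧ v = rel^ r (λ i → v (xs i))
    ⟦ a ≈ᶠ b ⟧ = D a b
    ⟦ ¬ᶠ φ ⟧ = complement ⟦ φ ⟧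
    ⟦ φ ∧ᶠ ψ ⟧ v = ⟦ φ ⟧ v × ⟦ ψ ⟧ v
    ⟦ φ ∨ᶠ ψ ⟧ v = ⟦ φ ⟧ v ⊎ ⟦ ψ ⟧ v
    ⟦ ∃ᶠ x φ ⟧ = C x ⟦ φ ⟧

-- Simultaneous induction on φ, since negation swaps eq and coeq. For a fixed
-- assignment v, "v x ≡ v y" is an equivalence relation on variables, so the
-- equivalence closures in eq and coeq cost nothing. The classical steps (falsity of
-- ¬φ or of φ ∧ ψ) go through because equality on the finite carrier is decidable.
module Submission where

open import Defs
open import Data.Product using (_×_; _,_)
open import Data.Sum using (inj₁; inj₂)
open import Data.Fin.Properties using (_≟_)
open import Function using (id; _∘_)
open import Relation.Nullary using (¬_)
open import Relation.Nullary.Decidable using (decidable-stable)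
open import Relation.Binary.PropositionalEquality as ≡ using (_≡_; refl)

EqCl⇒≡ : ∀ {L} {R : BinRel L} {A : Set} (f : Var L → A) →
         (∀ {a b} → R a b → f a ≡ f b) → ∀ {x y} → EqCl L R x y → f x ≡ f y
EqCl⇒≡ f R⇒≡ (base r)    = R⇒≡ r
EqCl⇒≡ f R⇒≡ refl        = refl
EqCl⇒≡ f R⇒≡ (sym e)     = ≡.sym (EqCl⇒≡ f R⇒≡ e)
EqCl⇒≡ f R⇒≡ (trans e d) = ≡.trans (EqCl⇒≡ f R⇒≡ e) (EqCl⇒≡ f R⇒≡ d)

module _ (L : Language) (M : Structure L) where
  open Sem L M

  D-stable : ∀ {x y} (v : Asg) → ¬ ¬ D x y v → D x y v
  D-stable {x} {y} v = decidable-stable (v x ≟ v y)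

  EqCl-⊆-D : ∀ {R : BinRel L} {V : Subset} → (∀ {a b} → R a b → V ⊆ D a b) →
             ∀ {x y} → EqCl L R x y → V ⊆ D x y
  EqCl-⊆-D R⇒⊆D e v v∈V = EqCl⇒≡ v (λ r → R⇒⊆D r v v∈V) e

  C-inflationary : ∀ z (V : Subset) → V ⊆ C z V
  C-inflationary z V v v∈V = v , v∈V , λ _ _ → refl

  C-preserves-D : ∀ {z a b} {V : Subset} → ¬ a ≡ z → ¬ b ≡ z →
                  V ⊆ D a b → C z V ⊆ D a b
  C-preserves-D a≢z b≢z V⊆D v (u , u∈V , u≈v) =
    ≡.trans (≡.sym (u≈v _ a≢z)) (≡.trans (V⊆D u u∈V) (u≈v _ b≢z))

  eq-sound   : ∀ φ {x y} → eq L φ x y → ⟦ φ ⟧ ⊆ D x y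
  coeq-sound : ∀ φ {x y} → coeq L φ x y → complement ⟦ φ ⟧ ⊆ D x y

  eq-sound one        refl _ _ = refl
  eq-sound (rel r xs) refl _ _ = refl
  eq-sound (a ≈ᶠ b)   = EqCl-⊆-D λ { (refl , refl) _ → id }
  eq-sound (¬ᶠ φ)     = coeq-sound φ
  eq-sound (φ ∧ᶠ ψ)   = EqCl-⊆-D λ
    { (inj₁ r) v (v∈φ , _) → eq-sound φ r v v∈φ
    ; (inj₂ r) v (_ , v∈ψ) → eq-sound ψ r v v∈ψ }
  eq-sound (φ ∨ᶠ ψ) (r , _) v (inj₁ v∈φ) = eq-sound φ r v v∈φ
  eq-sound (φ ∨ᶠ ψ) (_ , s) v (inj₂ v∈ψ) = eq-sound ψ s v v∈ψ
  eq-sound (∃ᶠ z φ)   = EqCl-⊆-D λ { (r , a≢z , b≢z) → C-preserves-D a≢z b≢z (eq-sound φ r) }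

  coeq-sound one        refl _ _ = refl
  coeq-sound (rel r xs) refl _ _ = refl
  coeq-sound (a ≈ᶠ b)   refl _ _ = refl
  coeq-sound (¬ᶠ φ) e v v∉¬φ = D-stable v λ v≉ → v∉¬φ (v≉ ∘ eq-sound φ e v)
  coeq-sound (φ ∧ᶠ ψ) (r , s) v v∉φ∧ψ = D-stable v λ v≉ →
    v≉ (coeq-sound φ r v λ v∈φ → v≉ (coeq-sound ψ s v λ v∈ψ → v∉φ∧ψ (v∈φ , v∈ψ)))
  coeq-sound (φ ∨ᶠ ψ)   = EqCl-⊆-D λ
    { (inj₁ r) v v∉φ∨ψ → coeq-sound φ r v (v∉φ∨ψ ∘ inj₁)
    ; (inj₂ r) v v∉φ∨ψ → coeq-sound ψ r v (v∉φ∨ψ ∘ inj₂) }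
  coeq-sound (∃ᶠ z φ)   = EqCl-⊆-D λ { (r , _ , _) v v∉∃φ →
    coeq-sound φ r v (v∉∃φ ∘ C-inflationary z ⟦ φ ⟧ v) }

lemma5p1 : (L : Language) (φ : Formula L) (x y : Var L) (M : Structure L) →
    (eq L φ x y → Sem._⊆_ L M (Sem.⟦_⟧ L M φ) (Sem.D L M x y))
    × (coeq L φ x y → Sem._⊆_ L M (Sem.complement L M (Sem.⟦_⟧ L M φ)) (Sem.D L M x y))
lemma5p1 L φ x y M = eq-sound L M φ , coeq-sound L M φ
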